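{- For every $n\geq1$, the map $d:\mathbf{I}_n(021)\rightarrow\mathcal{A}_n$ (the outline map) is a bijection, and for each $e\in\mathbf{I}_n(021)$, $$(\mathrm{dist}(e),\mathrm{asc}(e),\mathrm{zero}(e),\mathrm{ema}(e))=(\mathrm{turn}(d(e)),\mathrm{segment}(d(e)),\mathrm{red}(d(e)),\mathrm{return}(d(e))).$$
   Context: $\mathbf{I}_n$ is the set of integer sequences $e=(e_1,\dots,e_n)$ with $0\le e_i\le i-1$; $\mathbf{I}_n(021)$ is the subset of those avoiding the pattern $021$ (no $i<j<k$ with $e_i<e_k<e_j$). Statistics on $e$: $\mathrm{dist}(e)$ is the number of distinct positive entries of $e$; $\mathrm{asc}(e)=|\{i\in[n-1]:e_i<e_{i+1}\}|$; $\mathrm{zero}(e)$ is the number of $i$ with $e_i=0$; $\mathrm{ema}(e)=|\{i: e_i=i-1\}|$. A Dyck path of length $n$ is a lattice path from $(0,0)$ to $(n,n)$ with east steps $(1,0)$ and north steps $(0,1)$ never going above $y=x$; it is encoded by $d_1d_2\cdots d_n$, where $d_i$ (the height of the $i$-th east step) is the number of north steps before the $i$-th east step, so $0\le d_1\le\cdots\le d_n$ and $d_i\le i-1$. A two-colored Dyck path is a Dyck path each of whose east steps is colored black or red. $\mathcal{A}_n$ is the set of two-colored Dyck paths of length $n$ such that (c-1) every east step of height $0$ is red and (c-2) the first east step of each positive height is black. The outline $d(e)$ of $e\in\mathbf{I}_n(021)$ is the two-colored Dyck path whose $i$-th east step has height $e_i$ and color black if $e_i\neq0$, and height $\max\{e_1,\dots,e_i\}$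 and color red if $e_i=0$. Statistics on a two-colored Dyck path $D=d_1\cdots d_n$: $\mathrm{turn}(D)$ is the number of east steps immediately followed by a north step, minus $1$; $\mathrm{segment}(D)$ is the number of maximal strings of consecutive black east steps all of the same height; $\mathrm{red}(D)$ is the number of red east steps; $\mathrm{return}(D)$ is the number of times $D$ touches the diagonal after the first east step, i.e. $|\{i\in[n]: d_i=i-1\}|$. -}

module Defs where

open import Data.Nat using (ℕ; zero; suc; _+_; _∸_; _≤_; _<_; _⊔_; _≟_; _<?_)
open import Data.Fin using (Fin; toℕ)
import Data.Fin as F
open import Data.Vec using (Vec; []; _∷_; lookup; toList)
open import Data.List as L using (List; []; _∷_; length; filter; deduplicate; allFin)
open import Data.Product using (_×_; _,_; proj₁; proj₂)
open import Relation.Nullary using (¬_; does)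
open import Relation.Binary.PropositionalEquality using (_≡_; _≢_)
open import Data.Bool using (Bool; true; false; if_then_else_)

-- Inversion sequences (entries listed e₁ … eₙ; Fin-index i is position i+1)

IsInversionSeq : ∀ {n} → Vec ℕ n → Set
IsInversionSeq {n} e = ∀ (i : Fin n) → lookup e i ≤ toℕ i

Avoids021 : ∀ {n} → Vec ℕ n → Set
Avoids021 {n} e = ∀ (i j k : Fin n) → i F.< j → j F.< k →
  ¬ (lookup e i < lookup e k × lookup e k < lookup e j)

InI021 : ∀ {n} → Vec ℕ n → Set
InI021 e = IsInversionSeq e × Avoids021 e

dist : ∀ {n} → Vec ℕ n → ℕ
dist e = length (deduplicate _≟_ (filter (λ x → 0 <? x) (toList e)))

ascL : List ℕ → ℕ
ascL (x ∷ y ∷ r) = (if does (x <? y) then 1 else 0) + ascL (y ∷ r)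
ascL _ = 0

asc : ∀ {n} → Vec ℕ n → ℕ
asc e = ascL (toList e)

zeros : ∀ {n} → Vec ℕ n → ℕ
zeros e = length (filter (λ x → x ≟ 0) (toList e))

-- ema : number of i with e_i = i - 1  (0-based: e at index i equals i)
ema : ∀ {n} → Vec ℕ n → ℕ
ema {n} e = length (filter (λ i → lookup e i ≟ toℕ i) (allFin n))

-- Two-colored Dyck paths, encoded by the heights and colors of the east steps

data Color : Set where
  black red : Color

TwoColoredPath : ℕ → Set
TwoColoredPath n = Vec (ℕ × Color) n

height : ∀ {n} → TwoColoredPath n → Fin n → ℕ
height D i = proj₁ (lookup D i)

color : ∀ {n} → TwoColoredPath n → Fin n → Color
color D i = proj₂ (lookup D i)

IsDyck : ∀ {n} → TwoColoredPath n → Set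
IsDyck {n} D = (∀ (i : Fin n) → height D i ≤ toℕ i)
             × (∀ (i j : Fin n) → i F.≤ j → height D i ≤ height D j)

C1 : ∀ {n} → TwoColoredPath n → Set
C1 {n} D = ∀ (i : Fin n) → height D i ≡ 0 → color D i ≡ red

C2 : ∀ {n} → TwoColoredPath n → Set
C2 {n} D = ∀ (i : Fin n) → 0 < height D i →
  (∀ (j : Fin n) → j F.< i → height D j ≢ height D i) → color D i ≡ black

InA : ∀ {n} → TwoColoredPath n → Set
InA D = IsDyck D × C1 D × C2 D

-- m is the running maximum max{e₁,…,e_{i-1}} (0 initially)
outlineFrom : ∀ {k} → ℕ → Vec ℕ k → TwoColoredPath k
outlineFrom m [] = []
outlineFrom m (zero ∷ xs) = (m , red) ∷ outlineFrom m xs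
outlineFrom m (suc x ∷ xs) = (suc x , black) ∷ outlineFrom (m ⊔ suc x) xs

outline : ∀ {n} → Vec ℕ n → TwoColoredPath n
outline e = outlineFrom 0 e

-- number of east steps immediately followed by a north step, for a path
-- of length n given by its list of heights: step i (i < n) is followed by
-- a north step iff d_i < d_{i+1}; the last step iff d_n < n.
eastNorthL : ℕ → List ℕ → ℕ
eastNorthL n [] = 0
eastNorthL n (x ∷ []) = if does (x <? n) then 1 else 0
eastNorthL n (x ∷ y ∷ r) = (if does (x <? y) then 1 else 0) + eastNorthL n (y ∷ r)

heights : ∀ {n} → TwoColoredPath n → List ℕ
heights D = L.map proj₁ (toList D)

turn : ∀ {n} → TwoColoredPath n → ℕ
turn {n} D = eastNorthL n (heights D) ∸ 1

-- segment: number of maximal strings of consecutive black east steps of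
-- equal height; count black steps that start such a string.
-- The argument records the previous step (if it was black, its height).
data Prev : Set where
  none : Prev              -- no previous step, or previous step red
  blk  : ℕ → Prev

segmentFrom : Prev → List (ℕ × Color) → ℕ
segmentFrom p [] = 0
segmentFrom p ((h , red) ∷ r) = segmentFrom none r
segmentFrom none ((h , black) ∷ r) = 1 + segmentFrom (blk h) r
segmentFrom (blk h') ((h , black) ∷ r) =
  (if does (h' ≟ h) then 0 else 1) + segmentFrom (blk h) r

segment : ∀ {n} → TwoColoredPath n → ℕ
segment D = segmentFrom none (toList D)

isRed : Color → Bool
isRed red = true
isRed black = false

red# : ∀ {n} → TwoColoredPath n → ℕ
red# D = length (L.filter (λ s → Data.Bool._≟_ (isRed (proj₂ s)) true) (toList D))
  where import Data.Bool

-- return: |{i ∈ [n] : d_i = i - 1}|  (0-based: height at index i equals i)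
return# : ∀ {n} → TwoColoredPath n → ℕ
return# {n} D = length (filter (λ i → height D i ≟ toℕ i) (allFin n))

-- An inversion sequence avoids 021 exactly when its positive entries weakly increase
-- (its first entry is 0).  The outline then turns each positive entry into a black
-- step at that height and each zero into a red step at the running maximum, so
-- reading a black step as its height and a red step as 0 inverts it; on a weakly
-- increasing path, (c-1) and (c-2) say precisely that black steps are positive and
-- red steps stay at the current height.  The statistics are matched step by step:
-- ascents of e start black segments, the distinct positive entries are the ascents
-- of the height sequence, zeros are red steps, and a zero entry lies below the
-- diagonal except in the first position, where the red step does too.
module Submission where

open import Defs
open import Data.Nat using (ℕ; _≤_)
open import Data.Vec using (Vec)
open import Data.Product using (_×_; _,_; Σ; ∃)
open import Relation.Binary.PropositionalEquality using (_≡_)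

open import Data.Nat using (zero; suc; _+_; _∸_; _<_; _⊔_; _≟_; _<?_; z≤n; s≤s)
open import Data.Nat.Properties
open import Data.Fin using (Fin; toℕ) renaming (zero to fz; suc to fs)
import Data.Fin as F
open import Data.Fin.Properties using (toℕ<n)
open import Data.Vec using ([]; _∷_; lookup; toList; map)
open import Data.Vec.Properties using (lookup-map)
open import Data.List using (List; []; _∷_; length; filter; deduplicate; allFin)
open import Data.List.Properties using (filter-all; filter-reject; filter-idem; filter-≐)
open import Data.List.Relation.Unary.All as All using (All)
open import Data.List.Relation.Unary.All.Properties using (all-filter; deduplicate⁺)
open import Data.Product using (proj₁)
open import Data.Sum using (_⊎_; inj₁; inj₂; [_,_]; map₁)
open import Data.Empty using (⊥-elim)
open import Data.Unit using (⊤; tt)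
open import Data.Bool using (if_then_else_)
open import Function using (_∘_; id)
open import Function.Bundles using (_⇔_; mk⇔; Equivalence)
open import Relation.Nullary using (yes; no; does; ¬?)
open import Relation.Nullary.Decidable using (dec-true; dec-false)
open import Relation.Binary.PropositionalEquality using (refl; sym; trans; cong; cong₂; subst; _≢_; module ≡-Reasoning)

private
  variable
    k m : ℕ

PositivesIncreasingFrom : ℕ → Vec ℕ k → Set
PositivesIncreasingFrom m [] = ⊤
PositivesIncreasingFrom m (zero ∷ xs) = PositivesIncreasingFrom m xs
PositivesIncreasingFrom m (suc x ∷ xs) = m ≤ suc x × PositivesIncreasingFrom (suc x) xs

positivesIncreasingFrom : ∀ m (xs : Vec ℕ k) →
  (∀ l → 0 < lookup xs l → m ≤ lookup xs l) →
  (∀ j l → j F.< l → 0 < lookup xs l → lookup xs j ≤ lookup xs l) →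
  PositivesIncreasingFrom m xs
positivesIncreasingFrom m [] _ _ = tt
positivesIncreasingFrom m (zero ∷ xs) above increasing =
  positivesIncreasingFrom m xs (above ∘ fs) (λ j l → increasing (fs j) (fs l) ∘ s≤s)
positivesIncreasingFrom m (suc x ∷ xs) above increasing =
    above fz (s≤s z≤n)
  , positivesIncreasingFrom (suc x) xs (λ l → increasing fz (fs l) (s≤s z≤n))
                                       (λ j l → increasing (fs j) (fs l) ∘ s≤s)

inI021-head : ∀ {x} {xs : Vec ℕ k} → InI021 (x ∷ xs) → x ≡ 0
inI021-head (inv , _) = n≤0⇒n≡0 (inv fz)

-- The leading 0 is the "0" of a forbidden pattern 021.
inI021⇒positivesIncreasing : (e : Vec ℕ k) → InI021 e → PositivesIncreasingFrom 0 e
inI021⇒positivesIncreasing [] _ = tt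
inI021⇒positivesIncreasing (x ∷ xs) I@(_ , avoids) with inI021-head I
... | refl = positivesIncreasingFrom 0 xs (λ _ _ → z≤n) increasing
  where
  increasing : ∀ j l → j F.< l → 0 < lookup xs l → lookup xs j ≤ lookup xs l
  increasing j l j<l pos = ≮⇒≥ (λ l<j → avoids fz (fs j) (fs l) (s≤s z≤n) (s≤s j<l) (pos , l<j))

-- IsInversionSeq e is Bounded 0 e; p is the position of xs within the whole sequence.
Bounded : ℕ → Vec ℕ k → Set
Bounded {k} p xs = ∀ (i : Fin k) → lookup xs i ≤ p + toℕ i

Bounded-head : ∀ {p x} {xs : Vec ℕ k} → Bounded p (x ∷ xs) → x ≤ p
Bounded-head {p = p} b = ≤-trans (b fz) (≤-reflexive (+-identityʳ p))

Bounded-tail : ∀ {p x} {xs : Vec ℕ k} → Bounded p (x ∷ xs) → Bounded (suc p) xs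
Bounded-tail {p = p} b i = ≤-trans (b (fs i)) (≤-reflexive (+-suc p (toℕ i)))

-- The image of outlineFrom m, step by step; m is the current running maximum.
IsOutlineFrom : ℕ → TwoColoredPath k → Set
IsOutlineFrom m [] = ⊤
IsOutlineFrom m ((h , red) ∷ D) = h ≡ m × IsOutlineFrom m D
IsOutlineFrom m ((h , black) ∷ D) = 0 < h × m ≤ h × IsOutlineFrom h D

outlineFrom-isOutlineFrom : ∀ m (xs : Vec ℕ k) → PositivesIncreasingFrom m xs →
  IsOutlineFrom m (outlineFrom m xs)
outlineFrom-isOutlineFrom m [] _ = tt
outlineFrom-isOutlineFrom m (zero ∷ xs) inc = refl , outlineFrom-isOutlineFrom m xs inc
outlineFrom-isOutlineFrom m (suc x ∷ xs) (m≤x , inc) rewrite m≤n⇒m⊔n≡n m≤x =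
  s≤s z≤n , m≤x , outlineFrom-isOutlineFrom (suc x) xs inc

stepEntry : ℕ × Color → ℕ
stepEntry (h , red) = 0
stepEntry (h , black) = h

decode : TwoColoredPath k → Vec ℕ k
decode = map stepEntry

decode-outlineFrom : ∀ m (xs : Vec ℕ k) → decode (outlineFrom m xs) ≡ xs
decode-outlineFrom m [] = refl
decode-outlineFrom m (zero ∷ xs) = cong (0 ∷_) (decode-outlineFrom m xs)
decode-outlineFrom m (suc x ∷ xs) = cong (suc x ∷_) (decode-outlineFrom (m ⊔ suc x) xs)

outlineFrom-decode : ∀ m (D : TwoColoredPath k) → IsOutlineFrom m D → outlineFrom m (decode D) ≡ D
outlineFrom-decode m [] _ = refl
outlineFrom-decode m ((h , red) ∷ D) (refl , o) = cong ((m , red) ∷_) (outlineFrom-decode m D o)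
outlineFrom-decode m ((suc h , black) ∷ D) (_ , m≤h , o) rewrite m≤n⇒m⊔n≡n m≤h =
  cong ((suc h , black) ∷_) (outlineFrom-decode (suc h) D o)

outline-injective : {e e′ : Vec ℕ k} → outline e ≡ outline e′ → e ≡ e′
outline-injective {e = e} {e′} eq = begin
  e                   ≡⟨ sym (decode-outlineFrom 0 e) ⟩
  decode (outline e)  ≡⟨ cong decode eq ⟩
  decode (outline e′) ≡⟨ decode-outlineFrom 0 e′ ⟩
  e′                  ∎
  where open ≡-Reasoning

-- For m = 0 these are the conditions of InA other than the bound dᵢ ≤ i − 1.
record Admissible (m : ℕ) (D : TwoColoredPath k) : Set where
  field
    above       : ∀ i → m ≤ height D i
    increasing  : ∀ i j → i F.≤ j → height D i ≤ height D j
    zero-red    : C1 D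
    first-black : ∀ i → m < height D i → (∀ j → j F.< i → height D j ≢ height D i) →
                  color D i ≡ black
open Admissible

∷-admissible : ∀ {h c} {D : TwoColoredPath k} → m ≤ h → (h ≡ 0 → c ≡ red) → (m < h → c ≡ black) →
  Admissible h D → Admissible m ((h , c) ∷ D)
∷-admissible {m = m} {h} {c} {D} m≤h headRed headBlack A = record
  { above       = λ { fz → m≤h ; (fs i) → ≤-trans m≤h (above A i) }
  ; increasing  = increasing′
  ; zero-red    = λ { fz → headRed ; (fs i) → zero-red A i }
  ; first-black = firstBlack
  }
  where
  increasing′ : ∀ i j → i F.≤ j → height ((h , c) ∷ D) i ≤ height ((h , c) ∷ D) j
  increasing′ fz fz _ = ≤-refl
  increasing′ fz (fs j) _ = above A j
  increasing′ (fs i) (fs j) (s≤s i≤j) = increasing A i j i≤j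

  firstBlack : ∀ i → m < height ((h , c) ∷ D) i →
    (∀ j → j F.< i → height ((h , c) ∷ D) j ≢ height ((h , c) ∷ D) i) → color ((h , c) ∷ D) i ≡ black
  firstBlack fz m<h _ = headBlack m<h
  firstBlack (fs i) _ new =
    first-black A i (≤∧≢⇒< (above A i) (new fz (s≤s z≤n))) (λ j j<i → new (fs j) (s≤s j<i))

admissible-tail : ∀ {h c} {D : TwoColoredPath k} → Admissible m ((h , c) ∷ D) → Admissible h D
admissible-tail {h = h} {c} {D} A = record
  { above       = λ i → increasing A fz (fs i) z≤n
  ; increasing  = λ i j i≤j → increasing A (fs i) (fs j) (s≤s i≤j)
  ; zero-red    = zero-red A ∘ fs
  ; first-black = λ i h<hᵢ new → first-black A (fs i) (≤-<-trans (above A fz) h<hᵢ) (new′ i h<hᵢ new)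
  }
  where
  new′ : ∀ i → h < height D i → (∀ j → j F.< i → height D j ≢ height D i) →
         ∀ j → j F.< fs i → height ((h , c) ∷ D) j ≢ height ((h , c) ∷ D) (fs i)
  new′ i h<hᵢ _ fz _ h≡hᵢ = <-irrefl h≡hᵢ h<hᵢ
  new′ i _ new (fs j) (s≤s j<i) = new j j<i

isOutlineFrom⇒admissible : ∀ m (D : TwoColoredPath k) → IsOutlineFrom m D → Admissible m D
isOutlineFrom⇒admissible m [] _ = record
  { above = λ () ; increasing = λ () ; zero-red = λ () ; first-black = λ () }
isOutlineFrom⇒admissible m ((h , red) ∷ D) (refl , o) =
  ∷-admissible ≤-refl (λ _ → refl) (⊥-elim ∘ <-irrefl refl) (isOutlineFrom⇒admissible m D o)
isOutlineFrom⇒admissible m ((h , black) ∷ D) (0<h , m≤h , o) =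
  ∷-admissible m≤h (⊥-elim ∘ >⇒≢ 0<h) (λ _ → refl) (isOutlineFrom⇒admissible h D o)

red-height : ∀ {h} {D : TwoColoredPath k} → Admissible m ((h , red) ∷ D) → h ≡ m
red-height A = ≤-antisym (≮⇒≥ (λ m<h → redNotBlack (first-black A fz m<h (λ _ ())))) (above A fz)
  where
  redNotBlack : red ≢ black
  redNotBlack ()

admissible⇒isOutlineFrom : ∀ m (D : TwoColoredPath k) → Admissible m D → IsOutlineFrom m D
admissible⇒isOutlineFrom m [] _ = tt
admissible⇒isOutlineFrom m ((h , red) ∷ D) A with red-height A
... | refl = refl , admissible⇒isOutlineFrom m D (admissible-tail A)
admissible⇒isOutlineFrom m ((h , black) ∷ D) A =
  n≢0⇒n>0 (λ h≡0 → blackNotRed (zero-red A fz h≡0)) , above A fz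
  , admissible⇒isOutlineFrom h D (admissible-tail A)
  where
  blackNotRed : black ≢ red
  blackNotRed ()

outlineFrom-bounded : ∀ p m (xs : Vec ℕ k) → m ≤ p → Bounded p xs →
  ∀ i → height (outlineFrom m xs) i ≤ p + toℕ i
outlineFrom-bounded p m (zero ∷ xs) m≤p b fz = ≤-trans m≤p (m≤m+n p 0)
outlineFrom-bounded p m (suc x ∷ xs) m≤p b fz = b fz
outlineFrom-bounded p m (zero ∷ xs) m≤p b (fs i) rewrite +-suc p (toℕ i) =
  outlineFrom-bounded (suc p) m xs (m≤n⇒m≤1+n m≤p) (Bounded-tail b) i
outlineFrom-bounded p m (suc x ∷ xs) m≤p b (fs i) rewrite +-suc p (toℕ i) =
  outlineFrom-bounded (suc p) (m ⊔ suc x) xs (⊔-lub (m≤n⇒m≤1+n m≤p) (m≤n⇒m≤1+n (Bounded-head b)))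
                      (Bounded-tail b) i

outline-inA : (e : Vec ℕ k) → InI021 e → InA (outline e)
outline-inA e I@(inv , _) =
  (outlineFrom-bounded 0 0 e z≤n inv , increasing A) , zero-red A , first-black A
  where
  A : Admissible 0 (outline e)
  A = isOutlineFrom⇒admissible 0 (outline e)
        (outlineFrom-isOutlineFrom 0 e (inI021⇒positivesIncreasing e I))

stepEntry-≤ : ∀ s → stepEntry s ≤ proj₁ s
stepEntry-≤ (h , red) = z≤n
stepEntry-≤ (h , black) = ≤-refl

stepEntry-cases : ∀ s → stepEntry s ≡ 0 ⊎ stepEntry s ≡ proj₁ s
stepEntry-cases (h , red) = inj₁ refl
stepEntry-cases (h , black) = inj₂ refl

-- A positive entry equals its height, which dominates every earlier entry.
decode-inI021 : (D : TwoColoredPath k) → IsDyck D → InI021 (decode D)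
decode-inI021 D (bound , increasing) = (λ i → ≤-trans (entry≤height i) (bound i)) , avoids
  where
  entry≤height : ∀ i → lookup (decode D) i ≤ height D i
  entry≤height i rewrite lookup-map i stepEntry D = stepEntry-≤ (lookup D i)

  avoids : Avoids021 (decode D)
  avoids i j l _ j<l (eᵢ<eₗ , eₗ<eⱼ) rewrite lookup-map l stepEntry D
    with stepEntry-cases (lookup D l)
  ... | inj₁ eₗ≡0 = n≮0 (subst (_ <_) eₗ≡0 eᵢ<eₗ)
  ... | inj₂ eₗ≡hₗ =
    <⇒≱ eₗ<eⱼ (≤-trans (entry≤height j) (≤-trans (increasing j l (<⇒≤ j<l)) (≤-reflexive (sym eₗ≡hₗ))))

outline-surjective : (D : TwoColoredPath k) → InA D → Σ (Vec ℕ k) (λ e → InI021 e × outline e ≡ D)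
outline-surjective D (dyck@(_ , increasing) , zeroRed , firstBlack) =
  decode D , decode-inI021 D dyck , outlineFrom-decode 0 D (admissible⇒isOutlineFrom 0 D A)
  where
  A : Admissible 0 D
  A = record { above = λ _ → z≤n ; increasing = increasing ; zero-red = zeroRed ; first-black = firstBlack }

zeros≡red# : ∀ m (xs : Vec ℕ k) → zeros xs ≡ red# (outlineFrom m xs)
zeros≡red# m [] = refl
zeros≡red# m (zero ∷ xs) = cong suc (zeros≡red# m xs)
zeros≡red# m (suc x ∷ xs) = zeros≡red# (m ⊔ suc x) xs

-- Zero entries after the first lie strictly below the diagonal, and so do the red
-- steps, which sit at the maximum of earlier entries.
outlineFrom-diagonal : ∀ p m (xs : Vec ℕ k) → m < p ⊎ m ≡ 0 → Bounded p xs → ∀ i →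
  (lookup xs i ≡ p + toℕ i) ⇔ (height (outlineFrom m xs) i ≡ p + toℕ i)
outlineFrom-diagonal p m (zero ∷ xs) (inj₂ refl) b fz = mk⇔ id id
outlineFrom-diagonal p m (zero ∷ xs) (inj₁ m<p) b fz rewrite +-identityʳ p =
  mk⇔ (λ { refl → ⊥-elim (n≮0 m<p) }) (λ { refl → ⊥-elim (n≮n m m<p) })
outlineFrom-diagonal p m (suc x ∷ xs) _ b fz = mk⇔ id id
outlineFrom-diagonal p m (zero ∷ xs) m<p⊎m≡0 b (fs i) rewrite +-suc p (toℕ i) =
  outlineFrom-diagonal (suc p) m xs (map₁ m<n⇒m<1+n m<p⊎m≡0) (Bounded-tail b) i
outlineFrom-diagonal p m (suc x ∷ xs) m<p⊎m≡0 b (fs i) rewrite +-suc p (toℕ i) =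
  outlineFrom-diagonal (suc p) (m ⊔ suc x) xs (inj₁ (s≤s (⊔-lub m≤p (Bounded-head b)))) (Bounded-tail b) i
  where
  m≤p : m ≤ p
  m≤p = [ <⇒≤ , (λ { refl → z≤n }) ] m<p⊎m≡0

ema≡return# : (e : Vec ℕ k) → IsInversionSeq e → ema e ≡ return# (outline e)
ema≡return# {k} e inv = cong length
  (filter-≐ (λ i → lookup e i ≟ toℕ i) (λ i → height (outline e) i ≟ toℕ i)
            ((λ {i} → Equivalence.to (diagonal i)) , (λ {i} → Equivalence.from (diagonal i)))
            (allFin k))
  where
  diagonal : ∀ i → (lookup e i ≡ toℕ i) ⇔ (height (outline e) i ≡ toℕ i)
  diagonal = outlineFrom-diagonal 0 0 e (inj₂ refl) inv

prevStep : ℕ → Prev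
prevStep zero = none
prevStep (suc x) = blk (suc x)

ascent≡newSegment : ∀ {a b} → a ≤ b → (if does (a <? b) then 1 else 0) ≡ (if does (a ≟ b) then 0 else 1)
ascent≡newSegment {a} {b} a≤b with a ≟ b
... | yes refl rewrite dec-false (a <? a) (n≮n a) | dec-true (a ≟ a) refl = refl
... | no a≢b rewrite dec-true (a <? b) (≤∧≢⇒< a≤b a≢b) | dec-false (a ≟ b) a≢b = refl

-- Red heights do not affect segmentFrom, so the running maximum m′ is arbitrary.
ascL≡segmentFrom : ∀ x m m′ (xs : Vec ℕ k) → x ≤ m → PositivesIncreasingFrom m xs →
  ascL (x ∷ toList xs) ≡ segmentFrom (prevStep x) (toList (outlineFrom m′ xs))
ascL≡segmentFrom x m m′ [] _ _ = refl
ascL≡segmentFrom zero m m′ (zero ∷ xs) _ inc = ascL≡segmentFrom 0 m m′ xs z≤n inc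
ascL≡segmentFrom (suc w) m m′ (zero ∷ xs) _ inc = ascL≡segmentFrom 0 m m′ xs z≤n inc
ascL≡segmentFrom zero m m′ (suc z ∷ xs) _ (_ , inc) =
  cong suc (ascL≡segmentFrom (suc z) (suc z) (m′ ⊔ suc z) xs ≤-refl inc)
ascL≡segmentFrom (suc w) m m′ (suc z ∷ xs) w≤m (m≤z , inc) =
  cong₂ _+_ (ascent≡newSegment (≤-trans w≤m m≤z))
            (ascL≡segmentFrom (suc z) (suc z) (m′ ⊔ suc z) xs ≤-refl inc)

positives : Vec ℕ k → List ℕ
positives xs = filter (0 <?_) (toList xs)

distinct : List ℕ → ℕ
distinct L = length (deduplicate _≟_ L)

distinct-∷-repeat : ∀ x L → distinct (x ∷ x ∷ L) ≡ distinct (x ∷ L)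
distinct-∷-repeat x L = cong (suc ∘ length)
  (trans (filter-reject (¬? ∘ (x ≟_)) (λ x≢x → x≢x refl))
         (filter-idem (¬? ∘ (x ≟_)) (deduplicate _≟_ L)))

distinct-∷-fresh : ∀ x L → All (x ≢_) L → distinct (x ∷ L) ≡ suc (distinct L)
distinct-∷-fresh x L fresh = cong (suc ∘ length) (filter-all (¬? ∘ (x ≟_)) (deduplicate⁺ _≟_ fresh))

positives-above : ∀ m (xs : Vec ℕ k) → PositivesIncreasingFrom m xs → All (m ≤_) (positives xs)
positives-above m [] _ = All.[]
positives-above m (zero ∷ xs) inc = positives-above m xs inc
positives-above m (suc x ∷ xs) (m≤x , inc) = m≤x All.∷ All.map (≤-trans m≤x) (positives-above (suc x) xs inc)

-- The heights start at m and rise exactly to each new positive entry.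
ascents-outlineFrom : ∀ m (xs : Vec ℕ k) → PositivesIncreasingFrom m xs →
  suc (ascL (m ∷ heights (outlineFrom m xs))) ≡ distinct (m ∷ positives xs)
ascents-outlineFrom m [] _ = refl
ascents-outlineFrom m (zero ∷ xs) inc rewrite dec-false (m <? m) (n≮n m) = ascents-outlineFrom m xs inc
ascents-outlineFrom m (suc x ∷ xs) (m≤x , inc) rewrite m≤n⇒m⊔n≡n m≤x with m ≟ suc x
... | yes refl rewrite dec-false (m <? m) (n≮n m) =
  trans (ascents-outlineFrom m xs inc) (sym (distinct-∷-repeat m (positives xs)))
... | no m≢x rewrite dec-true (m <? suc x) (≤∧≢⇒< m≤x m≢x) =
  trans (cong suc (ascents-outlineFrom (suc x) xs inc))
        (sym (distinct-∷-fresh m (suc x ∷ positives xs)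
               (All.map (λ x≤y → <⇒≢ (<-≤-trans m<x x≤y)) (≤-refl All.∷ positives-above (suc x) xs inc))))
  where
  m<x : m < suc x
  m<x = ≤∧≢⇒< m≤x m≢x

eastNorthL≡suc-ascL : ∀ n x r → All (_< n) (x ∷ r) → eastNorthL n (x ∷ r) ≡ suc (ascL (x ∷ r))
eastNorthL≡suc-ascL n x [] (x<n All.∷ _) rewrite dec-true (x <? n) x<n = refl
eastNorthL≡suc-ascL n x (y ∷ r) (_ All.∷ below) =
  trans (cong ((if does (x <? y) then 1 else 0) +_) (eastNorthL≡suc-ascL n y r below)) (+-suc _ _)

heights-below : ∀ n (D : TwoColoredPath k) → (∀ i → height D i < n) → All (_< n) (heights D)
heights-below n [] _ = All.[]
heights-below n (s ∷ D) below = below fz All.∷ heights-below n D (below ∘ fs)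

dist≡turn : (xs : Vec ℕ k) → PositivesIncreasingFrom 0 xs →
  (∀ i → height (outline (0 ∷ xs)) i < suc k) → dist (0 ∷ xs) ≡ turn (outline (0 ∷ xs))
dist≡turn {k} xs inc below = begin
  distinct (positives xs)            ≡⟨ suc-injective ascents≡distinct ⟨
  ascL (heights (outline (0 ∷ xs)))  ≡⟨ cong (_∸ 1) (eastNorthL≡suc-ascL (suc k) 0 _ (heights-below _ _ below)) ⟨
  turn (outline (0 ∷ xs))            ∎
  where
  open ≡-Reasoning
  ascents≡distinct : suc (ascL (heights (outline (0 ∷ xs)))) ≡ suc (distinct (positives xs))
  ascents≡distinct = trans (ascents-outlineFrom 0 xs inc)
    (distinct-∷-fresh 0 (positives xs) (All.map <⇒≢ (all-filter (0 <?_) (toList xs))))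

outline-statistics : (e : Vec ℕ k) → InI021 e →
  (dist e , asc e , zeros e , ema e)
    ≡ (turn (outline e) , segment (outline e) , red# (outline e) , return# (outline e))
outline-statistics [] _ = refl
outline-statistics {suc k} (x ∷ xs) I@(inv , _) with inI021-head I
... | refl =
  cong₂ _,_ (dist≡turn xs inc below)
    (cong₂ _,_ (ascL≡segmentFrom 0 0 0 xs z≤n inc)
      (cong₂ _,_ (zeros≡red# 0 (0 ∷ xs)) (ema≡return# (0 ∷ xs) inv)))
  where
  inc : PositivesIncreasingFrom 0 xs
  inc = inI021⇒positivesIncreasing (0 ∷ xs) I
  below : ∀ i → height (outline (0 ∷ xs)) i < suc k
  below i = ≤-<-trans (proj₁ (proj₁ (outline-inA (0 ∷ xs) I)) i) (toℕ<n i)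

lemma4p2 : ∀ (n : ℕ) → 1 ≤ n →
    ((e : Vec ℕ n) → InI021 e → InA (outline e))
  × ((e e′ : Vec ℕ n) → InI021 e → InI021 e′ → outline e ≡ outline e′ → e ≡ e′)
  × ((D : TwoColoredPath n) → InA D → Σ (Vec ℕ n) (λ e → InI021 e × outline e ≡ D))
  × ((e : Vec ℕ n) → InI021 e →
      (dist e , asc e , zeros e , ema e)
        ≡ (turn (outline e) , segment (outline e) , red# (outline e) , return# (outline e)))
lemma4p2 n _ =
    outline-inA
  , (λ _ _ _ _ → outline-injective)
  , outline-surjective
  , outline-statistics
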